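{- Let $X$ be a finite alphabet with $|X|=N$, each symbol being of type GEN (acts on $\{0,1\}$ as the constant map $1$), PROP (acts as the identity) or KILL (acts as the constant map $0$), with $g,t,k$ the respective numbers of symbols, and $\mathfrak{d}=gt$. Let $a(L)$ be the number of cascade-free sequences in $X^L$. If $\mathfrak{d}>0$, then for all $L\ge 0$ \[a(L)=(\sqrt{\mathfrak{d}})^L\,U_L(x),\qquad x=\frac{N}{2\sqrt{\mathfrak{d}}},\] where $U_L$ is the Chebyshev polynomial of the second kind. Moreover $x\ge 1$, with equality if and only if $k=0$ and $g=t=N/2$.
   Context: For $x_1,\dots,x_L\in X^L$ define $\sigma_0=0$ and $\sigma_j=T_{x_j}(\sigma_{j-1})$, where $T_x$ is the map by which $x$ acts. The sequence is cascade-free if no $j$ has $x_j\in$ PROP and $\sigma_{j-1}=1$. Chebyshev polynomials of the second kind: $U_0(x)=1$, $U_1(x)=2x$, $U_n(x)=2xU_{n-1}(x)-U_{n-2}(x)$. -}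

module Defs where

open import Level using (Level)
open import Data.Bool using (Bool; true; false; _∧_; not)
open import Data.Nat using (ℕ; zero; suc)
open import Data.Fin using (Fin)
open import Data.Vec using (Vec; []; _∷_)
open import Data.List using (List; []; _∷_; [_]; map; concatMap; length; filterᵇ; allFin)
open import Algebra.Bundles using (CommutativeRing)

data SymType : Set where
  GEN PROP KILL : SymType

-- T_x : {0,1} → {0,1}, with 0 = false, 1 = true.
act : SymType → Bool → Bool
act GEN  _ = true
act PROP σ = σ
act KILL _ = false

isGEN isPROP isKILL : SymType → Bool
isGEN GEN = true
isGEN _   = false
isPROP PROP = true
isPROP _    = false
isKILL KILL = true
isKILL _    = false

countᵇ : {A : Set} → (A → Bool) → List A → ℕ
countᵇ p xs = length (filterᵇ p xs)

module Alphabet (N : ℕ) (type : Fin N → SymType) where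

  g t k 𝔡 : ℕ
  g = countᵇ (λ x → isGEN (type x)) (allFin N)
  t = countᵇ (λ x → isPROP (type x)) (allFin N)
  k = countᵇ (λ x → isKILL (type x)) (allFin N)
  𝔡 = g Data.Nat.* t

  cfFrom : ∀ {L} → Bool → Vec (Fin N) L → Bool
  cfFrom σ [] = true
  cfFrom σ (x ∷ xs) = not (isPROP (type x) ∧ σ) ∧ cfFrom (act (type x) σ) xs

  cascadeFree : ∀ {L} → Vec (Fin N) L → Bool
  cascadeFree = cfFrom false

  allWords : (L : ℕ) → List (Vec (Fin N) L)
  allWords zero = [ [] ]
  allWords (suc L) = concatMap (λ x → map (x ∷_) (allWords L)) (allFin N)

  a : ℕ → ℕ
  a L = countᵇ cascadeFree (allWords L)

module RingStuff {c ℓ : Level} (R : CommutativeRing c ℓ) where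
  open CommutativeRing R using (_+_; _*_; _-_; 0#)
  open CommutativeRing R public using (Carrier; _≈_; 1#) renaming (_*_ to _*R_)

  ι : ℕ → Carrier
  ι zero = 0#
  ι (suc n) = 1# + ι n

  pow : Carrier → ℕ → Carrier
  pow x zero = 1#
  pow x (suc n) = x * pow x n

  U : ℕ → Carrier → Carrier
  U zero x = 1#
  U (suc zero) x = ι 2 * x
  U (suc (suc n)) x = ι 2 * x * U (suc n) x - U n x

{-# OPTIONS --safe #-}
module Submission where

-- Let a_σ(L) count the words of length L that are cascade-free from state σ.
-- Splitting on the first symbol gives a₀(L+1) = g a₁(L) + (t + k) a₀(L) and
-- a₁(L+1) = g a₁(L) + k a₀(L); eliminating a₁ yields
-- a(L+2) + 𝔡 a(L) = N a(L+1) with a(0) = 1 and a(1) = N.  When s² = 𝔡 and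
-- 2 s x = N the sequence s^L U_L(x) satisfies the same recurrence with the same
-- initial values, so the two agree.  The inequality is AM-GM in the form
-- N² − 4gt = (g − t)² + 2k(g + t) + k², which vanishes iff k = 0 and g = t.

open import Defs
open import Level using (Level; 0ℓ)
open import Data.Bool using (Bool; true; false; T?; not; _∧_)
import Data.Nat as ℕ
open ℕ using (ℕ; zero; suc)
open import Data.Fin using (Fin)
open import Data.Vec using (_∷_)
open import Data.List using (List; []; _∷_; _++_; map; concatMap; length; filterᵇ; allFin)
open import Data.Nat.ListAction using (sum)
open import Data.List.Properties using (length-++; filter-++; map-cong; length-tabulate)
open import Data.Product using (_×_; _,_; proj₁; ∃-syntax)
open import Data.Sum using (inj₁; inj₂; [_,_]′)
open import Function using (_∘_; id)
open import Function.Bundles using (_⇔_; mk⇔)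
open import Relation.Binary.PropositionalEquality
  using (_≡_; refl; sym; trans; cong; cong₂; subst; module ≡-Reasoning)
open import Algebra.Bundles using (CommutativeRing)

module ChebyshevSequences {c ℓ : Level} (R : CommutativeRing c ℓ) where

  open CommutativeRing R renaming (refl to ≈-refl; sym to ≈-sym; trans to ≈-trans)
  open RingStuff R using (ι; pow; U)
  open import Algebra.Properties.Semiring.Mult semiring
    using (×-homo-+; ×1-homo-*) renaming (_×_ to _·_)
  open import Algebra.Properties.Group +-group using (//-rightDividesʳ)
  open import Algebra.Properties.Ring ring using (x[y-z]≈xy-xz)
  open import Algebra.Solver.CommutativeMonoid *-commutativeMonoid using (solve; _⊜_; _⊕_) renaming (id to ε)
  open import Relation.Binary.Reasoning.Setoid setoid

  ι≡·1# : ∀ n → ι n ≡ n · 1#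
  ι≡·1# zero    = refl
  ι≡·1# (suc n) = cong (1# +_) (ι≡·1# n)

  ι-homo-+ : ∀ m n → ι (m ℕ.+ n) ≈ ι m + ι n
  ι-homo-+ m n = begin
    ι (m ℕ.+ n)       ≡⟨ ι≡·1# (m ℕ.+ n) ⟩
    (m ℕ.+ n) · 1#    ≈⟨ ×-homo-+ 1# m n ⟩
    m · 1# + n · 1#   ≡⟨ cong₂ _+_ (ι≡·1# m) (ι≡·1# n) ⟨
    ι m + ι n         ∎

  ι-homo-* : ∀ m n → ι (m ℕ.* n) ≈ ι m * ι n
  ι-homo-* m n = begin
    ι (m ℕ.* n)         ≡⟨ ι≡·1# (m ℕ.* n) ⟩
    (m ℕ.* n) · 1#      ≈⟨ ×1-homo-* m n ⟩
    (m · 1#) * (n · 1#) ≡⟨ cong₂ _*_ (ι≡·1# m) (ι≡·1# n) ⟨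
    ι m * ι n           ∎

  Recurrent : Carrier → Carrier → (ℕ → Carrier) → Set ℓ
  Recurrent A B V = ∀ n → V (suc (suc n)) ≈ A * V (suc n) - B * V n

  recurrent-unique : ∀ {A B} {V W : ℕ → Carrier} → Recurrent A B V → Recurrent A B W →
                     V 0 ≈ W 0 → V 1 ≈ W 1 → ∀ n → V n ≈ W n
  recurrent-unique {A} {B} {V} {W} recV recW V0≈W0 V1≈W1 = proj₁ ∘ agree
    where
    agree : ∀ n → V n ≈ W n × V (suc n) ≈ W (suc n)
    agree zero    = V0≈W0 , V1≈W1
    agree (suc n) with agree n
    ... | Vn≈Wn , Vsn≈Wsn = Vsn≈Wsn , (begin
      V (suc (suc n))              ≈⟨ recV n ⟩
      A * V (suc n) - B * V n      ≈⟨ +-cong (*-congˡ Vsn≈Wsn) (-‿cong (*-congˡ Vn≈Wn)) ⟩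
      A * W (suc n) - B * W n      ≈⟨ recW n ⟨
      W (suc (suc n))              ∎)

  ι-recurrent : ∀ {A B} (u : ℕ → ℕ) →
                (∀ n → u (suc (suc n)) ℕ.+ B ℕ.* u n ≡ A ℕ.* u (suc n)) →
                Recurrent (ι A) (ι B) (ι ∘ u)
  ι-recurrent {A} {B} u rec n = begin
    ι (u (suc (suc n)))                                 ≈⟨ //-rightDividesʳ (ι B * ι (u n)) _ ⟨
    ι (u (suc (suc n))) + ι B * ι (u n) - ι B * ι (u n)  ≈⟨ +-congʳ moved ⟩
    ι A * ι (u (suc n)) - ι B * ι (u n)                 ∎
    where
    moved : ι (u (suc (suc n))) + ι B * ι (u n) ≈ ι A * ι (u (suc n))
    moved = begin
      ι (u (suc (suc n))) + ι B * ι (u n)  ≈⟨ +-congˡ (ι-homo-* B (u n)) ⟨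
      ι (u (suc (suc n))) + ι (B ℕ.* u n)  ≈⟨ ι-homo-+ (u (suc (suc n))) (B ℕ.* u n) ⟨
      ι (u (suc (suc n)) ℕ.+ B ℕ.* u n)    ≡⟨ cong ι (rec n) ⟩
      ι (A ℕ.* u (suc n))                  ≈⟨ ι-homo-* A (u (suc n)) ⟩
      ι A * ι (u (suc n))                  ∎

  scaledU-recurrent : ∀ {A B s x} → s * s ≈ B → ι 2 * s * x ≈ A →
                      Recurrent A B (λ n → pow s n * U n x)
  scaledU-recurrent {A} {B} {s} {x} s²≈B 2sx≈A n = begin
    s * (s * P) * (ι 2 * x * U₁ - U₀)                   ≈⟨ x[y-z]≈xy-xz _ _ _ ⟩
    s * (s * P) * (ι 2 * x * U₁) - s * (s * P) * U₀
      ≈⟨ +-cong (solve 5 (λ s P c x U → (s ⊕ (s ⊕ P)) ⊕ ((c ⊕ x) ⊕ U) ⊜ ((c ⊕ s) ⊕ x) ⊕ ((s ⊕ P) ⊕ U)) ≈-refl s P (ι 2) x U₁)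
                (-‿cong (solve 3 (λ s P U → (s ⊕ (s ⊕ P)) ⊕ U ⊜ (s ⊕ s) ⊕ (P ⊕ U)) ≈-refl s P U₀)) ⟩
    (ι 2 * s * x) * (s * P * U₁) - (s * s) * (P * U₀)   ≈⟨ +-cong (*-congʳ 2sx≈A) (-‿cong (*-congʳ s²≈B)) ⟩
    A * (s * P * U₁) - B * (P * U₀)                     ∎
    where
    P U₁ U₀ : Carrier
    P  = pow s n
    U₁ = U (suc n) x
    U₀ = U n x

  2s[uy]≈u : ∀ {s y} u → ι 2 * s * y ≈ 1# → ι 2 * s * (u * y) ≈ u
  2s[uy]≈u {s} {y} u 2sy≈1 = begin
    ι 2 * s * (u * y)   ≈⟨ solve 4 (λ c s u y → (c ⊕ s) ⊕ (u ⊕ y) ⊜ u ⊕ ((c ⊕ s) ⊕ y)) ≈-refl (ι 2) s u y ⟩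
    u * (ι 2 * s * y)   ≈⟨ *-congˡ 2sy≈1 ⟩
    u * 1#              ≈⟨ *-identityʳ u ⟩
    u                   ∎

  chebyshev-closed-form : ∀ {A B s x} {V : ℕ → Carrier} → s * s ≈ B → ι 2 * s * x ≈ A →
                          Recurrent A B V → V 0 ≈ 1# → V 1 ≈ A →
                          ∀ n → V n ≈ pow s n * U n x
  chebyshev-closed-form {A} {B} {s} {x} {V} s²≈B 2sx≈A recV V0≈1 V1≈A =
    recurrent-unique recV (scaledU-recurrent s²≈B 2sx≈A) V0≈U0 V1≈U1
    where
    V0≈U0 : V 0 ≈ 1# * 1#
    V0≈U0 = ≈-trans V0≈1 (≈-sym (*-identityˡ 1#))
    V1≈U1 : V 1 ≈ s * 1# * (ι 2 * x)
    V1≈U1 = begin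
      V 1               ≈⟨ V1≈A ⟩
      A                 ≈⟨ 2sx≈A ⟨
      ι 2 * s * x       ≈⟨ solve 3 (λ c s x → (c ⊕ s) ⊕ x ⊜ (s ⊕ ε) ⊕ (c ⊕ x)) ≈-refl (ι 2) s x ⟩
      s * 1# * (ι 2 * x) ∎

open import Data.Nat using (_+_; _*_; _≤_; _<_)
open import Data.Nat.Properties
  using (≤-total; m≤n⇒∃[o]m+o≡n; m≤m+n; m+n≡0⇒m≡0; m+n≡0⇒n≡0; m*n≡0⇒m≡0∨n≡0; +-cancelˡ-≡; +-suc; +-identityʳ; *-zeroʳ)
open import Data.Nat.Tactic.RingSolver using (solve-∀)

module _ {A : Set} where

  countᵇ-++ : (p : A → Bool) (xs ys : List A) →
              countᵇ p (xs ++ ys) ≡ countᵇ p xs + countᵇ p ys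
  countᵇ-++ p xs ys =
    trans (cong length (filter-++ (T? ∘ p) xs ys)) (length-++ (filterᵇ p xs))

  countᵇ-map : {B : Set} (p : A → Bool) (f : B → A) (xs : List B) →
               countᵇ p (map f xs) ≡ countᵇ (p ∘ f) xs
  countᵇ-map p f [] = refl
  countᵇ-map p f (x ∷ xs) with p (f x)
  ... | true  = cong suc (countᵇ-map p f xs)
  ... | false = countᵇ-map p f xs

  countᵇ-concatMap : {B : Set} (p : A → Bool) (f : B → List A) (xs : List B) →
                     countᵇ p (concatMap f xs) ≡ sum (map (countᵇ p ∘ f) xs)
  countᵇ-concatMap p f [] = refl
  countᵇ-concatMap p f (x ∷ xs) =
    trans (countᵇ-++ p (f x) (concatMap f xs))
          (cong (countᵇ p (f x) +_) (countᵇ-concatMap p f xs))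

  countᵇ-const-false : (xs : List A) → countᵇ (λ _ → false) xs ≡ 0
  countᵇ-const-false []       = refl
  countᵇ-const-false (x ∷ xs) = countᵇ-const-false xs

module ByType {A : Set} (type : A → SymType) where

  #GEN #PROP #KILL : List A → ℕ
  #GEN  = countᵇ (isGEN ∘ type)
  #PROP = countᵇ (isPROP ∘ type)
  #KILL = countᵇ (isKILL ∘ type)

  length-by-type : (xs : List A) → length xs ≡ #GEN xs + #PROP xs + #KILL xs
  length-by-type [] = refl
  length-by-type (x ∷ xs) with type x
  ... | GEN  = cong suc (length-by-type xs)
  ... | PROP = trans (cong suc (length-by-type xs))
                     (sym (cong (_+ #KILL xs) (+-suc (#GEN xs) (#PROP xs))))
  ... | KILL = trans (cong suc (length-by-type xs))
                     (sym (+-suc (#GEN xs + #PROP xs) (#KILL xs)))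

  sum-by-type : (F : SymType → ℕ) (xs : List A) →
                sum (map (F ∘ type) xs) ≡ #GEN xs * F GEN + #PROP xs * F PROP + #KILL xs * F KILL
  sum-by-type F [] = refl
  sum-by-type F (x ∷ xs) with type x
  ... | GEN  = trans (cong (F GEN +_) (sum-by-type F xs)) (add-GEN (#GEN xs) (#PROP xs) (#KILL xs) _ _ _)
    where add-GEN : ∀ a b c u v w → u + (a * u + b * v + c * w) ≡ suc a * u + b * v + c * w
          add-GEN = solve-∀
  ... | PROP = trans (cong (F PROP +_) (sum-by-type F xs)) (add-PROP (#GEN xs) (#PROP xs) (#KILL xs) _ _ _)
    where add-PROP : ∀ a b c u v w → v + (a * u + b * v + c * w) ≡ a * u + suc b * v + c * w
          add-PROP = solve-∀
  ... | KILL = trans (cong (F KILL +_) (sum-by-type F xs)) (add-KILL (#GEN xs) (#PROP xs) (#KILL xs) _ _ _)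
    where add-KILL : ∀ a b c u v w → w + (a * u + b * v + c * w) ≡ a * u + b * v + suc c * w
          add-KILL = solve-∀

module CascadeFreeCounting (N : ℕ) (type : Fin N → SymType) where
  open Alphabet N type
  open ByType type
  open ≡-Reasoning

  N≡g+t+k : N ≡ g + t + k
  N≡g+t+k = trans (sym (length-tabulate id)) (length-by-type (allFin N))

  aFrom : Bool → ℕ → ℕ
  aFrom σ L = countᵇ (cfFrom σ) (allWords L)

  afterSymbol : Bool → SymType → ℕ → ℕ
  afterSymbol σ τ L = countᵇ (λ w → not (isPROP τ ∧ σ) ∧ cfFrom (act τ σ) w) (allWords L)

  aFrom-suc : ∀ σ L → aFrom σ (suc L) ≡
              g * afterSymbol σ GEN L + t * afterSymbol σ PROP L + k * afterSymbol σ KILL L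
  aFrom-suc σ L = begin
    countᵇ (cfFrom σ) (concatMap (λ x → map (x ∷_) (allWords L)) (allFin N))
      ≡⟨ countᵇ-concatMap (cfFrom σ) (λ x → map (x ∷_) (allWords L)) (allFin N) ⟩
    sum (map (λ x → countᵇ (cfFrom σ) (map (x ∷_) (allWords L))) (allFin N))
      ≡⟨ cong sum (map-cong (λ x → countᵇ-map (cfFrom σ) (x ∷_) (allWords L)) (allFin N)) ⟩
    sum (map (λ x → afterSymbol σ (type x) L) (allFin N))
      ≡⟨ sum-by-type (λ τ → afterSymbol σ τ L) (allFin N) ⟩
    g * afterSymbol σ GEN L + t * afterSymbol σ PROP L + k * afterSymbol σ KILL L ∎

  a-suc : ∀ L → a (suc L) ≡ g * aFrom true L + t * a L + k * a L
  a-suc = aFrom-suc false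

  aFrom-true-suc : ∀ L → aFrom true (suc L) ≡ g * aFrom true L + k * a L
  aFrom-true-suc L = begin
    aFrom true (suc L)                                            ≡⟨ aFrom-suc true L ⟩
    g * aFrom true L + t * afterSymbol true PROP L + k * a L
      ≡⟨ cong (λ z → g * aFrom true L + t * z + k * a L) (countᵇ-const-false (allWords L)) ⟩
    g * aFrom true L + t * 0 + k * a L
      ≡⟨ cong (λ z → g * aFrom true L + z + k * a L) (*-zeroʳ t) ⟩
    g * aFrom true L + 0 + k * a L
      ≡⟨ cong (_+ k * a L) (+-identityʳ (g * aFrom true L)) ⟩
    g * aFrom true L + k * a L                                    ∎

  a-one : a 1 ≡ N
  a-one = begin
    a 1                   ≡⟨ a-suc 0 ⟩
    g * 1 + t * 1 + k * 1 ≡⟨ times-one g t k ⟩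
    g + t + k             ≡⟨ sym N≡g+t+k ⟩
    N                     ∎
    where times-one : ∀ g t k → g * 1 + t * 1 + k * 1 ≡ g + t + k
          times-one = solve-∀

  a-recurrence : ∀ L → a (suc (suc L)) + 𝔡 * a L ≡ N * a (suc L)
  a-recurrence L = begin
    a (suc (suc L)) + g * t * P
      ≡⟨ cong (_+ g * t * P) (a-suc (suc L)) ⟩
    g * aFrom true (suc L) + t * a (suc L) + k * a (suc L) + g * t * P
      ≡⟨ cong₂ (λ u v → g * u + t * v + k * v + g * t * P) (aFrom-true-suc L) (a-suc L) ⟩
    g * (g * Q + k * P) + t * (g * Q + t * P + k * P) + k * (g * Q + t * P + k * P) + g * t * P
      ≡⟨ eliminate g t k P Q ⟩
    (g + t + k) * (g * Q + t * P + k * P)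
      ≡⟨ cong₂ _*_ (sym N≡g+t+k) (sym (a-suc L)) ⟩
    N * a (suc L) ∎
    where
    P Q : ℕ
    P = a L
    Q = aFrom true L
    eliminate : ∀ g t k P Q →
      g * (g * Q + k * P) + t * (g * Q + t * P + k * P) + k * (g * Q + t * P + k * P) + g * t * P
        ≡ (g + t + k) * (g * Q + t * P + k * P)
    eliminate = solve-∀

  a-chebyshev : ∀ {c ℓ} (R : CommutativeRing c ℓ) → let open RingStuff R in
                (s y : Carrier) → s *R s ≈ ι 𝔡 → (ι 2 *R s) *R y ≈ 1# →
                (L : ℕ) → ι (a L) ≈ pow s L *R U L (ι N *R y)
  a-chebyshev R s y s²≈𝔡 2sy≈1 =
    chebyshev-closed-form s²≈𝔡 (2s[uy]≈u (ι N) 2sy≈1) (ι-recurrent {N} {𝔡} a a-recurrence)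
      (CommutativeRing.+-identityʳ R _) (CommutativeRing.reflexive R (cong ι a-one))
    where
    open RingStuff R using (ι)
    open ChebyshevSequences R

excess≡0⇒d≡0×k≡0 : ∀ u d k → 4 * u * k + (d + k) * (d + k) ≡ 0 → d ≡ 0 × k ≡ 0
excess≡0⇒d≡0×k≡0 u d k e = m+n≡0⇒m≡0 d d+k≡0 , m+n≡0⇒n≡0 d d+k≡0
  where
  d+k≡0 : d + k ≡ 0
  d+k≡0 = [ id , id ]′ (m*n≡0⇒m≡0∨n≡0 (d + k) (m+n≡0⇒n≡0 (4 * u * k) e))

square-excess : ∀ g t k → ∃[ e ] ((g + t + k) * (g + t + k) ≡ 4 * (g * t) + e × (e ≡ 0 → k ≡ 0 × g ≡ t))
square-excess g t k with ≤-total g t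
... | inj₁ g≤t with (d , refl) ← m≤n⇒∃[o]m+o≡n g≤t =
  4 * g * k + (d + k) * (d + k) , expand g d k , balanced
  where
  expand : ∀ u d k → (u + (u + d) + k) * (u + (u + d) + k) ≡ 4 * (u * (u + d)) + (4 * u * k + (d + k) * (d + k))
  expand = solve-∀
  balanced : 4 * g * k + (d + k) * (d + k) ≡ 0 → k ≡ 0 × g ≡ g + d
  balanced e with (refl , refl) ← excess≡0⇒d≡0×k≡0 g d k e = refl , sym (+-identityʳ g)
... | inj₂ t≤g with (d , refl) ← m≤n⇒∃[o]m+o≡n t≤g =
  4 * t * k + (d + k) * (d + k) , expand t d k , balanced
  where
  expand : ∀ u d k → (u + d + u + k) * (u + d + u + k) ≡ 4 * ((u + d) * u) + (4 * u * k + (d + k) * (d + k))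
  expand = solve-∀
  balanced : 4 * t * k + (d + k) * (d + k) ≡ 0 → k ≡ 0 × t + d ≡ t
  balanced e with (refl , refl) ← excess≡0⇒d≡0×k≡0 t d k e = refl , +-identityʳ t

four-mul≤square : ∀ g t k → 4 * (g * t) ≤ (g + t + k) * (g + t + k)
four-mul≤square g t k with (e , square≡ , _) ← square-excess g t k =
  subst (4 * (g * t) ≤_) (sym square≡) (m≤m+n (4 * (g * t)) e)

four-mul≡square⇔ : ∀ g t k → (4 * (g * t) ≡ (g + t + k) * (g + t + k)) ⇔ (k ≡ 0 × 2 * g ≡ g + t + k × 2 * t ≡ g + t + k)
four-mul≡square⇔ g t k = mk⇔ balanced square
  where
  twice : ∀ g → 2 * g ≡ g + g + 0
  twice = solve-∀
  balanced : 4 * (g * t) ≡ (g + t + k) * (g + t + k) → k ≡ 0 × 2 * g ≡ g + t + k × 2 * t ≡ g + t + k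
  balanced eq with square-excess g t k
  ... | e , square≡ , balanced-if-zero
        with balanced-if-zero (+-cancelˡ-≡ (4 * (g * t)) e 0 (trans (sym (trans eq square≡)) (sym (+-identityʳ _))))
  ... | refl , refl =
    refl , twice g , twice g
  square : k ≡ 0 × 2 * g ≡ g + t + k × 2 * t ≡ g + t + k → 4 * (g * t) ≡ (g + t + k) * (g + t + k)
  square (_ , 2g≡N , 2t≡N) = trans (four-mul g t) (cong₂ _*_ 2g≡N 2t≡N)
    where four-mul : ∀ g t → 4 * (g * t) ≡ 2 * g * (2 * t)
          four-mul = solve-∀

theorem4p1 : (N : ℕ) (type : Fin N → SymType) →
    let open Alphabet N type in
    0 < 𝔡 →
    ( (R : CommutativeRing 0ℓ 0ℓ) →
        let open RingStuff R in
        (s y : Carrier) → s *R s ≈ ι 𝔡 → (ι 2 *R s) *R y ≈ 1# →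
        (L : ℕ) → ι (a L) ≈ pow s L *R U L (ι N *R y) )
    × (4 * 𝔡 ≤ N * N)
    × ((4 * 𝔡 ≡ N * N) ⇔ (k ≡ 0 × 2 * g ≡ N × 2 * t ≡ N))
theorem4p1 N type _ =
  a-chebyshev ,
  subst (λ m → 4 * 𝔡 ≤ m * m) (sym N≡g+t+k) (four-mul≤square g t k) ,
  subst (λ m → (4 * 𝔡 ≡ m * m) ⇔ (k ≡ 0 × 2 * g ≡ m × 2 * t ≡ m)) (sym N≡g+t+k) (four-mul≡square⇔ g t k)
  where
  open Alphabet N type
  open CascadeFreeCounting N type
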